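{- Let $(s_1,\dots, s_{n-1})$ be the comply-constrain slither code of a rooted tree $T$ on $n$ vertices. Let $\beta$ be the smallest number such that the prefix $(s_1,\dots, s_\beta)$ contains at least $n-1-\beta$ distinct doublets (i.e. at least $n-1-\beta$ distinct numbers each occurring at least twice in the prefix). Then the maximum number of edges in a path-collection in $T$ is the number of symbols that remain in $(s_1,\dots, s_\beta)$ if we discard the third and following occurrence of each number.
   Context: Let $T$ be a tree on $n$ vertices labelled $1,\dots,n$, rooted at one of them, with all edges directed away from the root. A path-collection is a set of edges of which no more than two meet at any vertex. In comply-constrain Slither, the vertices are classified from the leaves up: a vertex is a $P$-position if and only if it has at most one $P$-position among its children, and otherwise it is an $N$-position. The comply-constrain slither code is computed as follows: start with $n-1$ empty slots for an auxiliary sequence $(a_1,\dots,a_{n-1})$; repeatedly remove from the tree the leaf with the smallest label and insert its label into the leftmost empty slot if it is a $P$-position, and into the rightmost empty slot if it is an $N$-position (the $P/N$ classification is relative to the original tree and is not updated as leaves are removed); continue until only the root remains. Then $s_i$ is defined as the parent of $a_i$ in $T$. -}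

module Defs where

open import Data.Nat using (ℕ; zero; suc; _∸_; _≤_; _<_; _≤ᵇ_; _<ᵇ_; _+_)
open import Data.Bool using (Bool; true; false; _∧_; not; if_then_else_)
open import Data.Fin using (Fin)
open import Data.Fin.Properties using (_≟_)
open import Data.Fin.Subset using (Subset; ∣_∣; inside; outside; Side)
open import Data.Vec using (lookup)
open import Data.List using (List; []; _∷_; _++_; [_]; length; filterᵇ; take; map; allFin; reverse; head)
open import Data.Bool.ListAction using (any; all)
open import Data.Maybe using (Maybe; just; nothing)
open import Data.Product using (Σ; _×_; ∃)
open import Function.Bundles using (_⇔_)
open import Relation.Binary.PropositionalEquality using (_≡_; _≢_)
open import Relation.Nullary.Decidable using (⌊_⌋)
open import Function.Base using (_∘_)

iter : ∀ {A : Set} → (A → A) → ℕ → A → A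
iter f zero    x = x
iter f (suc k) x = f (iter f k x)

-- A rooted tree on the vertex set Fin n (labels 0,…,n-1 in place of 1,…,n,
-- with the same order).  Each non-root vertex v has the edge v → parent v
-- (directed away from the root); parent root = root is a dummy value.
record RootedTree (n : ℕ) : Set where
  field
    root     : Fin n
    parent   : Fin n → Fin n
    parent-root : parent root ≡ root
    reaches  : ∀ v → ∃ λ k → iter parent k v ≡ root

isInside : Side → Bool
isInside inside  = true
isInside outside = false

module _ {n : ℕ} (T : RootedTree n) where
  open RootedTree T

  _==_ : Fin n → Fin n → Bool
  x == y = ⌊ x ≟ y ⌋

  isRoot : Fin n → Bool
  isRoot v = v == root

  isChild : Fin n → Fin n → Bool
  isChild c v = not (isRoot c) ∧ (parent c == v)

  children : Fin n → List (Fin n)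
  children v = filterᵇ (λ c → isChild c v) (allFin n)

  countChildren : (Fin n → Bool) → Fin n → ℕ
  countChildren P v = length (filterᵇ P (children v))

  -- P is the comply-constrain Slither P/N classification of T
  -- (P v ≡ true means v is a P-position, false means N-position):
  -- v is a P-position iff at most one of its children is a P-position.
  IsPNClassification : (Fin n → Bool) → Set
  IsPNClassification P = ∀ v → (P v ≡ true) ⇔ (countChildren (λ c → P c) v ≤ 1)

  elem : Fin n → List (Fin n) → Bool
  elem v xs = any (v ==_) xs

  isCurrentLeaf : List (Fin n) → Fin n → Bool
  isCurrentLeaf removed v =
    not (isRoot v) ∧ not (elem v removed) ∧ all (λ c → elem c removed) (children v)

  smallestLeaf : List (Fin n) → Maybe (Fin n)
  smallestLeaf removed = head (filterᵇ (isCurrentLeaf removed) (allFin n))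

  removeLeaves : ℕ → List (Fin n) → List (Fin n)
  removeLeaves zero    removed = removed
  removeLeaves (suc k) removed with smallestLeaf removed
  ... | nothing = removed
  ... | just v  = removeLeaves k (removed ++ [ v ])

  removalOrder : List (Fin n)
  removalOrder = removeLeaves (n ∸ 1) []

  -- Filling slots: `left` holds the filled leftmost slots (most recent first),
  -- `right` holds the filled rightmost slots (leftmost first).
  fillSlots : (Fin n → Bool) → List (Fin n) → List (Fin n) → List (Fin n) → List (Fin n)
  fillSlots P []       left right = reverse left ++ right
  fillSlots P (v ∷ vs) left right =
    if P v then fillSlots P vs (v ∷ left) right
           else fillSlots P vs left (v ∷ right)

  auxSeq : (Fin n → Bool) → List (Fin n)
  auxSeq P = fillSlots P removalOrder [] []

  slitherCode : (Fin n → Bool) → List (Fin n)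
  slitherCode P = map parent (auxSeq P)

  -- Path-collections.  An edge set is a subset E of the vertices: v ∈ E
  -- stands for the edge from parent v to v (v not the root).
  inE : Subset n → Fin n → Bool
  inE E v = isInside (lookup E v)

  degreeIn : Subset n → Fin n → ℕ
  degreeIn E v = length (filterᵇ (inE E) (children v)) + (if inE E v then 1 else 0)

  IsPathCollection : Subset n → Set
  IsPathCollection E = (lookup E root ≡ outside) × (∀ v → degreeIn E v ≤ 2)

  IsMaxPathCollectionSize : ℕ → Set
  IsMaxPathCollectionSize m =
    (Σ (Subset n) λ E → IsPathCollection E × ∣ E ∣ ≡ m) ×
    (∀ E → IsPathCollection E → ∣ E ∣ ≤ m)

module _ {n : ℕ} where
  private
    _=='_ : Fin n → Fin n → Bool
    x ==' y = ⌊ x ≟ y ⌋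

  occurrences : Fin n → List (Fin n) → ℕ
  occurrences x xs = length (filterᵇ (x =='_) xs)

  doublets : List (Fin n) → ℕ
  doublets xs = length (filterᵇ (λ x → 2 ≤ᵇ occurrences x xs) (allFin n))

  discardThirdGo : List (Fin n) → List (Fin n) → List (Fin n)
  discardThirdGo seen []       = []
  discardThirdGo seen (x ∷ xs) =
    if occurrences x seen <ᵇ 2
      then x ∷ discardThirdGo (seen ++ [ x ]) xs
      else discardThirdGo seen xs

  discardThird : List (Fin n) → List (Fin n)
  discardThird = discardThirdGo []

{-# OPTIONS --safe #-}
-- Leaves are removed children-first and the P-positions fill the leftmost slots in the
-- order of removal, so the code starts with the parents of the non-root P-positions, and
-- in this prefix every vertex occurs once per P-child.  Its doublets are therefore exactly
-- the N-positions.  Counting then shows that β is the length p of this prefix, or p - 1 if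
-- the root is an N-position; in that case the omitted last symbol is the parent of the
-- last P-position, which is an N-position (a parent is removed after its children) and
-- already occurs twice.  Either way, discarding third occurrences leaves
-- Σ_v min(2, number of P-children of v) symbols.
--
-- This many edges form a path-collection: keep the edges to the first two P-children of
-- every vertex, which has degree at most 2 since a P-position has at most one P-child.
-- No path-collection is larger: at each vertex v, the used edges to children of v, plus
-- one if v is an N-position whose own edge is used, number at most min(2, P-children of v)
-- plus the used edges from v to N-children, because an N-position has two P-children and
-- its own edge leaves room for only one child edge.  Summed over v, the extra terms on
-- both sides count the used edges into N-positions and cancel.
module Submission where

open import Defs
open import Algebra.Properties.CommutativeSemigroup as CommutativeSemigroupProperties using ()
open import Data.Bool using (Bool; true; false; _∧_; _∨_; not; if_then_else_)
open import Data.Bool.ListAction using (any; all)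
open import Data.Bool.Properties
  using (∨-conicalˡ; ∨-conicalʳ; ∨-zeroʳ; ∧-identityʳ; ∧-conicalˡ; ∧-conicalʳ; ∧-zeroʳ; ∧-comm; not-involutive)
open import Data.Empty using (⊥; ⊥-elim)
open import Data.Fin using (Fin; zero; suc)
open import Data.Fin.Properties using (_≟_)
open import Data.Fin.Subset using (Subset; ∣_∣)
open import Data.List
  using (List; []; _∷_; _++_; [_]; length; filterᵇ; map; head; allFin; take; reverse; initLast; _∷ʳ′_)
open import Data.List.Extrema.Nat using (argmax; f[xs]≤f[argmax]; f[⊥]≤f[argmax])
open import Data.List.Membership.Propositional using (_∈_)
open import Data.List.Membership.Propositional.Properties using (∈-allFin)
open import Data.List.Properties
  using (map-tabulate; ++-identityʳ; ++-assoc; take-all; length-++; length-tabulate; length-map; map-++;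
         unfold-reverse; ∷-injectiveˡ; ∷-injectiveʳ)
import Data.List.Relation.Unary.All as All
open import Data.List.Relation.Unary.Any using (here; there)
open import Data.Maybe using (just)
open import Data.Nat using (ℕ; zero; suc; _+_; _∸_; _⊓_; _≤_; _<_; _≤ᵇ_; _<ᵇ_; z≤n; s≤s; z<s)
open import Data.Nat.Properties hiding (_≟_; ≡ᵇ⇒≡; ≡⇒≡ᵇ)
open import Data.Product using (Σ; _×_; _,_; proj₁; proj₂; map₁)
open import Data.Sum using (_⊎_; inj₁; inj₂)
open import Data.Unit using (⊤)
open import Data.Vec using (lookup)
import Data.Vec as Vec
open import Data.Vec.Properties using (lookup∘tabulate)
open import Function.Base using (_∘_; id)
open import Function.Bundles using (Equivalence)
open import Relation.Nullary using (yes; no)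
open import Relation.Nullary.Decidable using (⌊_⌋)
open import Relation.Binary.PropositionalEquality hiding ([_])

open CommutativeSemigroupProperties +-commutativeSemigroup using (interchange)

private variable
  A B : Set
  k m : ℕ

-- Lists, sums and Boolean counts

bit : Bool → ℕ
bit b = if b then 1 else 0

sumBy : (A → ℕ) → List A → ℕ
sumBy f []       = 0
sumBy f (x ∷ xs) = f x + sumBy f xs

countᵇ : (A → Bool) → List A → ℕ
countᵇ p = sumBy (bit ∘ p)

sumBy-cong : {f g : A → ℕ} → (∀ x → f x ≡ g x) → ∀ xs → sumBy f xs ≡ sumBy g xs
sumBy-cong f≗g []       = refl
sumBy-cong f≗g (x ∷ xs) = cong₂ _+_ (f≗g x) (sumBy-cong f≗g xs)

sumBy-mono : {f g : A → ℕ} → (∀ x → f x ≤ g x) → ∀ xs → sumBy f xs ≤ sumBy g xs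
sumBy-mono f≤g []       = z≤n
sumBy-mono f≤g (x ∷ xs) = +-mono-≤ (f≤g x) (sumBy-mono f≤g xs)

sumBy-+ : (f g : A → ℕ) (xs : List A) → sumBy (λ x → f x + g x) xs ≡ sumBy f xs + sumBy g xs
sumBy-+ f g []       = refl
sumBy-+ f g (x ∷ xs) rewrite sumBy-+ f g xs = interchange (f x) (g x) (sumBy f xs) (sumBy g xs)

sumBy-zero : (xs : List A) → sumBy (λ _ → 0) xs ≡ 0
sumBy-zero []       = refl
sumBy-zero (x ∷ xs) = sumBy-zero xs

sumBy-swap : (f : A → B → ℕ) (xs : List A) (ys : List B) →
             sumBy (λ x → sumBy (f x) ys) xs ≡ sumBy (λ y → sumBy (λ x → f x y) xs) ys
sumBy-swap f []       ys = sym (sumBy-zero ys)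
sumBy-swap f (x ∷ xs) ys rewrite sumBy-swap f xs ys = sym (sumBy-+ (f x) _ ys)

length-filterᵇ : (p : A → Bool) (xs : List A) → length (filterᵇ p xs) ≡ countᵇ p xs
length-filterᵇ p []       = refl
length-filterᵇ p (x ∷ xs) with p x
... | true  = cong suc (length-filterᵇ p xs)
... | false = length-filterᵇ p xs

countᵇ-cong : {p q : A → Bool} → (∀ x → p x ≡ q x) → ∀ xs → countᵇ p xs ≡ countᵇ q xs
countᵇ-cong p≗q = sumBy-cong (cong bit ∘ p≗q)

bit-mono : {a b : Bool} → (a ≡ true → b ≡ true) → bit a ≤ bit b
bit-mono {false} a⇒b = z≤n
bit-mono {true}  a⇒b rewrite a⇒b refl = ≤-refl

countᵇ-mono : {p q : A → Bool} → (∀ x → p x ≡ true → q x ≡ true) → ∀ xs → countᵇ p xs ≤ countᵇ q xs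
countᵇ-mono p⇒q = sumBy-mono (bit-mono ∘ p⇒q)

countᵇ-filterᵇ : (p q : A → Bool) (xs : List A) → countᵇ q (filterᵇ p xs) ≡ countᵇ (λ x → p x ∧ q x) xs
countᵇ-filterᵇ p q []       = refl
countᵇ-filterᵇ p q (x ∷ xs) with p x
... | true  = cong (bit (q x) +_) (countᵇ-filterᵇ p q xs)
... | false = countᵇ-filterᵇ p q xs

countᵇ-++ : (p : A → Bool) (xs ys : List A) → countᵇ p (xs ++ ys) ≡ countᵇ p xs + countᵇ p ys
countᵇ-++ p []       ys = refl
countᵇ-++ p (x ∷ xs) ys rewrite countᵇ-++ p xs ys = sym (+-assoc (bit (p x)) _ _)

countᵇ-map : (q : B → Bool) (f : A → B) (xs : List A) → countᵇ q (map f xs) ≡ countᵇ (q ∘ f) xs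
countᵇ-map q f []       = refl
countᵇ-map q f (x ∷ xs) = cong (bit (q (f x)) +_) (countᵇ-map q f xs)

countᵇ-split : (p q : A → Bool) (xs : List A) →
               countᵇ p xs ≡ countᵇ (λ x → p x ∧ q x) xs + countᵇ (λ x → p x ∧ not (q x)) xs
countᵇ-split p q xs = trans (sumBy-cong (λ x → bit-split (p x) (q x)) xs) (sumBy-+ _ _ xs)
  where
  bit-split : (a b : Bool) → bit a ≡ bit (a ∧ b) + bit (a ∧ not b)
  bit-split false b     = refl
  bit-split true  false = refl
  bit-split true  true  = refl

countᵇ-true : (xs : List A) → countᵇ (λ _ → true) xs ≡ length xs
countᵇ-true []       = refl
countᵇ-true (x ∷ xs) = cong suc (countᵇ-true xs)

countᵇ<⇒witness : (p q : A → Bool) (xs : List A) → countᵇ p xs < countᵇ q xs →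
                  Σ A λ x → q x ≡ true × p x ≡ false
countᵇ<⇒witness p q (x ∷ xs) lt with p x in px | q x in qx
... | false | true  = x , qx , px
... | true  | true  = countᵇ<⇒witness p q xs (≤-pred lt)
... | false | false = countᵇ<⇒witness p q xs lt
... | true  | false = countᵇ<⇒witness p q xs (≤-trans (n≤1+n _) lt)

countᵇ-mono-tight : {p q : A → Bool} → (∀ x → p x ≡ true → q x ≡ true) →
                    ∀ {xs} → countᵇ q xs ≤ countᵇ p xs → ∀ {x} → x ∈ xs → q x ≡ true → p x ≡ true
countᵇ-mono-tight {p = p} {q} p⇒q {y ∷ xs} q≤p (here refl) qy =
  bit-reflect qy (+-cancelʳ-≤ (countᵇ p xs) (bit (q y)) (bit (p y))
                   (≤-trans (+-monoʳ-≤ (bit (q y)) (countᵇ-mono p⇒q xs)) q≤p))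
  where
  bit-reflect : {a b : Bool} → b ≡ true → bit b ≤ bit a → a ≡ true
  bit-reflect {true}  _    _  = refl
  bit-reflect {false} refl ()
countᵇ-mono-tight {p = p} {q} p⇒q {y ∷ xs} q≤p (there x∈xs) =
  countᵇ-mono-tight p⇒q (+-cancelˡ-≤ (bit (p y)) (countᵇ q xs) (countᵇ p xs)
                          (≤-trans (+-monoˡ-≤ (countᵇ q xs) (bit-mono (p⇒q y))) q≤p)) x∈xs

take-++ˡ : (k : ℕ) (xs ys : List A) → k ≤ length xs → take k (xs ++ ys) ≡ take k xs
take-++ˡ zero    xs       ys _         = refl
take-++ˡ (suc k) (x ∷ xs) ys (s≤s k≤) = cong (x ∷_) (take-++ˡ k xs ys k≤)

take-length-++ : (xs ys : List A) → take (length xs) (xs ++ ys) ≡ xs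
take-length-++ xs ys = trans (take-++ˡ (length xs) xs ys ≤-refl) (take-all (length xs) xs ≤-refl)

least-witness : (p : ℕ → Bool) (K : ℕ) → p K ≡ true →
                Σ ℕ λ k → p k ≡ true × (∀ j → j < k → p j ≡ false)
least-witness p zero    pK = 0 , pK , λ _ ()
least-witness p (suc K) pK with p 0 in p0
... | true  = 0 , p0 , λ _ ()
... | false with least-witness (p ∘ suc) K pK
...   | k , pk , below = suc k , pk , λ { zero _ → p0 ; (suc j) (s≤s j<k) → below j j<k }

∷ʳ-decomposition : (xs : List A) → 0 < length xs → Σ (List A) λ ys → Σ A λ c → xs ≡ ys ++ [ c ]
∷ʳ-decomposition xs 0<len with initLast xs
∷ʳ-decomposition .[]            () | []
∷ʳ-decomposition .(ys ++ [ c ]) _  | ys ∷ʳ′ c = ys , c , refl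

∨-introˡ : {a : Bool} (b : Bool) → a ≡ true → a ∨ b ≡ true
∨-introˡ b refl = refl

∨-introʳ : (a : Bool) {b : Bool} → b ≡ true → a ∨ b ≡ true
∨-introʳ a refl = ∨-zeroʳ a

_≡ᵇ_ : Fin m → Fin m → Bool
x ≡ᵇ y = ⌊ x ≟ y ⌋

≡ᵇ-refl : (x : Fin m) → x ≡ᵇ x ≡ true
≡ᵇ-refl x with x ≟ x
... | yes _  = refl
... | no x≢x = ⊥-elim (x≢x refl)

≡ᵇ⇒≡ : {x y : Fin m} → x ≡ᵇ y ≡ true → x ≡ y
≡ᵇ⇒≡ {x = x} {y} eq with x ≟ y
... | yes x≡y = x≡y

≢⇒≡ᵇ-false : {x y : Fin m} → x ≢ y → x ≡ᵇ y ≡ false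
≢⇒≡ᵇ-false {x = x} {y} x≢y with x ≟ y
... | yes x≡y = ⊥-elim (x≢y x≡y)
... | no _    = refl

≡ᵇ-false⇒≢ : {x y : Fin m} → x ≡ᵇ y ≡ false → x ≢ y
≡ᵇ-false⇒≢ {x = x} x≢ᵇx refl rewrite ≡ᵇ-refl x with () ← x≢ᵇx

≡ᵇ-sym : (x y : Fin m) → x ≡ᵇ y ≡ y ≡ᵇ x
≡ᵇ-sym x y with x ≟ y | y ≟ x
... | yes _   | yes _   = refl
... | no _    | no _    = refl
... | yes x≡y | no y≢x  = ⊥-elim (y≢x (sym x≡y))
... | no x≢y  | yes y≡x = ⊥-elim (x≢y (sym y≡x))

suc-≡ᵇ : (x y : Fin m) → suc x ≡ᵇ suc y ≡ x ≡ᵇ y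
suc-≡ᵇ x y with x ≟ y
... | yes _ = refl
... | no _  = refl

_∈ᵇ_ : Fin m → List (Fin m) → Bool
x ∈ᵇ xs = any (x ≡ᵇ_) xs

Unique : List (Fin m) → Set
Unique []       = ⊤
Unique (x ∷ xs) = (x ∈ᵇ xs ≡ false) × Unique xs

∈ᵇ-∷⁻ : {x y : Fin m} (xs : List (Fin m)) → x ∈ᵇ (y ∷ xs) ≡ true → x ≡ y ⊎ x ∈ᵇ xs ≡ true
∈ᵇ-∷⁻ {x = x} {y} xs x∈ with x ≡ᵇ y in x≡ᵇy
... | true  = inj₁ (≡ᵇ⇒≡ x≡ᵇy)
... | false = inj₂ x∈

∈ᵇ-∷ʳ⁻ : {x y : Fin m} (xs : List (Fin m)) → x ∈ᵇ (xs ++ [ y ]) ≡ true → x ∈ᵇ xs ≡ true ⊎ x ≡ y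
∈ᵇ-∷ʳ⁻ []       x∈ with ∈ᵇ-∷⁻ [] x∈
... | inj₁ x≡y = inj₂ x≡y
∈ᵇ-∷ʳ⁻ {x = x} (z ∷ xs) x∈ with x ≡ᵇ z
... | true  = inj₁ refl
... | false = ∈ᵇ-∷ʳ⁻ xs x∈

∈ᵇ-∷ʳ⁺ʳ : (x : Fin m) (xs : List (Fin m)) → x ∈ᵇ (xs ++ [ x ]) ≡ true
∈ᵇ-∷ʳ⁺ʳ x []       rewrite ≡ᵇ-refl x = refl
∈ᵇ-∷ʳ⁺ʳ x (z ∷ xs) with x ≡ᵇ z
... | true  = refl
... | false = ∈ᵇ-∷ʳ⁺ʳ x xs

∈ᵇ-∷ʳ⁺ˡ : {x : Fin m} (y : Fin m) (xs : List (Fin m)) → x ∈ᵇ xs ≡ true → x ∈ᵇ (xs ++ [ y ]) ≡ true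
∈ᵇ-∷ʳ⁺ˡ {x = x} y (z ∷ xs) x∈ with x ≡ᵇ z
... | true  = refl
... | false = ∈ᵇ-∷ʳ⁺ˡ y xs x∈

Unique-∷ʳ : {x : Fin m} (xs : List (Fin m)) → Unique xs → x ∈ᵇ xs ≡ false → Unique (xs ++ [ x ])
Unique-∷ʳ []       _           _   = refl , _
Unique-∷ʳ {x = x} (z ∷ xs) (z∉xs , u) x∉ = z∉ , Unique-∷ʳ xs u (∨-conicalʳ _ _ x∉)
  where
  z∉ : z ∈ᵇ (xs ++ [ x ]) ≡ false
  z∉ with z ∈ᵇ (xs ++ [ x ]) in z∈
  ... | false = refl
  ... | true with ∈ᵇ-∷ʳ⁻ xs z∈
  ...   | inj₁ z∈xs with () ← trans (sym z∉xs) z∈xs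
  ...   | inj₂ refl = ⊥-elim (≡ᵇ-false⇒≢ (∨-conicalˡ (z ≡ᵇ z) _ x∉) refl)

∈ᵇ-filterᵇ⁻ : (q : Fin m → Bool) {x : Fin m} (xs : List (Fin m)) →
              x ∈ᵇ filterᵇ q xs ≡ true → x ∈ᵇ xs ≡ true × q x ≡ true
∈ᵇ-filterᵇ⁻ q {x} (y ∷ xs) x∈ with q y in qy
... | false = map₁ (∨-introʳ (x ≡ᵇ y)) (∈ᵇ-filterᵇ⁻ q xs x∈)
... | true with ∈ᵇ-∷⁻ (filterᵇ q xs) x∈
...   | inj₁ refl = ∨-introˡ _ (≡ᵇ-refl x) , qy
...   | inj₂ x∈′  = map₁ (∨-introʳ (x ≡ᵇ y)) (∈ᵇ-filterᵇ⁻ q xs x∈′)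

∈ᵇ-filterᵇ⁺ : (q : Fin m → Bool) {x : Fin m} (xs : List (Fin m)) →
              x ∈ᵇ xs ≡ true → q x ≡ true → x ∈ᵇ filterᵇ q xs ≡ true
∈ᵇ-filterᵇ⁺ q {x} (y ∷ xs) x∈ qx with q y in qy | ∈ᵇ-∷⁻ xs x∈
... | true  | inj₁ refl = ∨-introˡ _ (≡ᵇ-refl x)
... | true  | inj₂ x∈′  = ∨-introʳ (x ≡ᵇ y) (∈ᵇ-filterᵇ⁺ q xs x∈′ qx)
... | false | inj₁ refl with () ← trans (sym qy) qx
... | false | inj₂ x∈′  = ∈ᵇ-filterᵇ⁺ q xs x∈′ qx

Unique-filterᵇ : (q : Fin m → Bool) (xs : List (Fin m)) → Unique xs → Unique (filterᵇ q xs)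
Unique-filterᵇ q []       _           = _
Unique-filterᵇ q (y ∷ xs) (y∉xs , u) with q y
... | false = Unique-filterᵇ q xs u
... | true  = y∉ , Unique-filterᵇ q xs u
  where
  y∉ : y ∈ᵇ filterᵇ q xs ≡ false
  y∉ with y ∈ᵇ filterᵇ q xs in y∈
  ... | false = refl
  ... | true with () ← trans (sym y∉xs) (proj₁ (∈ᵇ-filterᵇ⁻ q xs y∈))

all-filterᵇ⁺ : (p q : A → Bool) → (∀ x → q x ≡ true → p x ≡ true) → (xs : List A) → all p (filterᵇ q xs) ≡ true
all-filterᵇ⁺ p q q⇒p []       = refl
all-filterᵇ⁺ p q q⇒p (y ∷ xs) with q y in qy
... | true rewrite q⇒p y qy = all-filterᵇ⁺ p q q⇒p xs
... | false = all-filterᵇ⁺ p q q⇒p xs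

all-filterᵇ⁻ : (p q : A → Bool) {xs : List A} → all p (filterᵇ q xs) ≡ true →
               ∀ {x} → x ∈ xs → q x ≡ true → p x ≡ true
all-filterᵇ⁻ p q {y ∷ xs} all-p x∈ qx with q y in qy | x∈
... | true  | here refl = ∧-conicalˡ _ _ all-p
... | true  | there x∈′ = all-filterᵇ⁻ p q (∧-conicalʳ (p y) _ all-p) x∈′ qx
... | false | here refl with () ← trans (sym qy) qx
... | false | there x∈′ = all-filterᵇ⁻ p q all-p x∈′ qx

head-filterᵇ : (p : A → Bool) {xs : List A} {x : A} → x ∈ xs → p x ≡ true →
               Σ A λ v → head (filterᵇ p xs) ≡ just v × p v ≡ true
head-filterᵇ p {y ∷ xs} x∈ px with p y in py | x∈
... | true  | _         = y , refl , py
... | false | here refl with () ← trans (sym py) px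
... | false | there x∈′ = head-filterᵇ p x∈′ px

countᵇ-allFin-suc : (p : Fin (suc m) → Bool) →
                    countᵇ p (allFin (suc m)) ≡ bit (p zero) + countᵇ (p ∘ suc) (allFin m)
countᵇ-allFin-suc {m} p =
  cong (bit (p zero) +_) (trans (cong (countᵇ p) (sym (map-tabulate id suc))) (countᵇ-map p suc (allFin m)))

countᵇ-allFin-≡ᵇ : (x : Fin m) (q : Fin m → Bool) → countᵇ (λ v → v ≡ᵇ x ∧ q v) (allFin m) ≡ bit (q x)
countᵇ-allFin-≡ᵇ {suc m} zero q =
  trans (countᵇ-allFin-suc (λ v → v ≡ᵇ zero ∧ q v))
        (trans (cong (bit (q zero) +_) (sumBy-zero (allFin m))) (+-identityʳ _))
countᵇ-allFin-≡ᵇ {suc m} (suc x) q =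
  trans (countᵇ-allFin-suc (λ v → v ≡ᵇ suc x ∧ q v))
        (trans (countᵇ-cong (λ v → cong (_∧ q (suc v)) (suc-≡ᵇ v x)) (allFin m))
               (countᵇ-allFin-≡ᵇ x (q ∘ suc)))

countᵇ-allFin-∈ᵇ : (q : Fin m → Bool) (xs : List (Fin m)) → Unique xs →
                   countᵇ (λ v → v ∈ᵇ xs ∧ q v) (allFin m) ≡ countᵇ q xs
countᵇ-allFin-∈ᵇ {m} q []       _          = sumBy-zero (allFin m)
countᵇ-allFin-∈ᵇ {m} q (x ∷ xs) (x∉xs , u) = begin
  countᵇ (λ v → (v ≡ᵇ x ∨ v ∈ᵇ xs) ∧ q v) (allFin m)
    ≡⟨ sumBy-cong (λ v → bit-∨ (v ≡ᵇ x) (v ∈ᵇ xs) (q v) (disjoint v)) (allFin m) ⟩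
  sumBy (λ v → bit (v ≡ᵇ x ∧ q v) + bit (v ∈ᵇ xs ∧ q v)) (allFin m)
    ≡⟨ sumBy-+ _ _ (allFin m) ⟩
  countᵇ (λ v → v ≡ᵇ x ∧ q v) (allFin m) + countᵇ (λ v → v ∈ᵇ xs ∧ q v) (allFin m)
    ≡⟨ cong₂ _+_ (countᵇ-allFin-≡ᵇ x q) (countᵇ-allFin-∈ᵇ q xs u) ⟩
  countᵇ q (x ∷ xs) ∎
  where
  open ≡-Reasoning
  bit-∨ : (a b c : Bool) → a ∧ b ≡ false → bit ((a ∨ b) ∧ c) ≡ bit (a ∧ c) + bit (b ∧ c)
  bit-∨ false b     c _ = refl
  bit-∨ true  false c _ = sym (+-identityʳ (bit c))
  disjoint : ∀ v → v ≡ᵇ x ∧ v ∈ᵇ xs ≡ false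
  disjoint v with v ≟ x
  ... | yes refl = x∉xs
  ... | no _     = refl

countᵇ-allFin-∈ᵇ≡length : (xs : List (Fin m)) → Unique xs → countᵇ (_∈ᵇ xs) (allFin m) ≡ length xs
countᵇ-allFin-∈ᵇ≡length {m} xs u =
  trans (countᵇ-cong (λ v → sym (∧-identityʳ (v ∈ᵇ xs))) (allFin m))
        (trans (countᵇ-allFin-∈ᵇ (λ _ → true) xs u) (countᵇ-true xs))

isInside-id : ∀ b → isInside b ≡ b
isInside-id true  = refl
isInside-id false = refl

∣∣≡countᵇ : (E : Subset m) → ∣ E ∣ ≡ countᵇ (isInside ∘ lookup E) (allFin m)
∣∣≡countᵇ {zero}  Vec.[]          = refl
∣∣≡countᵇ {suc m} (true Vec.∷ E)  =
  trans (cong suc (∣∣≡countᵇ E)) (sym (countᵇ-allFin-suc (isInside ∘ lookup (true Vec.∷ E))))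
∣∣≡countᵇ {suc m} (false Vec.∷ E) =
  trans (∣∣≡countᵇ E) (sym (countᵇ-allFin-suc (isInside ∘ lookup (false Vec.∷ E))))

-- Third occurrences and doublets

occurrences≡countᵇ : (x : Fin m) (xs : List (Fin m)) → occurrences x xs ≡ countᵇ (x ≡ᵇ_) xs
occurrences≡countᵇ x = length-filterᵇ (x ≡ᵇ_)

<ᵇ2⇒≤1 : ∀ {a} → (a <ᵇ 2) ≡ true → a ≤ 1
<ᵇ2⇒≤1 {zero}     _ = z≤n
<ᵇ2⇒≤1 {suc zero} _ = s≤s z≤n

≮ᵇ2⇒2≤ : ∀ {a} → (a <ᵇ 2) ≡ false → 2 ≤ a
≮ᵇ2⇒2≤ {suc (suc a)} _ = s≤s (s≤s z≤n)

countᵇ-∷ʳ : (p : Fin m → Bool) (xs : List (Fin m)) (x : Fin m) → countᵇ p (xs ++ [ x ]) ≡ countᵇ p xs + bit (p x)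
countᵇ-∷ʳ p xs x = trans (countᵇ-++ p xs [ x ]) (cong (countᵇ p xs +_) (+-identityʳ (bit (p x))))

countᵇ-discardThirdGo : (seen xs : List (Fin m)) → (∀ v → countᵇ (v ≡ᵇ_) seen ≤ 2) → ∀ v →
  countᵇ (v ≡ᵇ_) (seen ++ discardThirdGo seen xs) ≡ 2 ⊓ (countᵇ (v ≡ᵇ_) seen + countᵇ (v ≡ᵇ_) xs)
countᵇ-discardThirdGo seen [] seen≤2 v
  rewrite ++-identityʳ seen | +-identityʳ (countᵇ (v ≡ᵇ_) seen) = sym (m≥n⇒m⊓n≡n (seen≤2 v))
countᵇ-discardThirdGo seen (x ∷ xs) seen≤2 v with occurrences x seen <ᵇ 2 in fresh
... | true = begin
  countᵇ (v ≡ᵇ_) (seen ++ x ∷ discardThirdGo (seen ++ [ x ]) xs)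
    ≡⟨ cong (countᵇ (v ≡ᵇ_)) (sym (++-assoc seen [ x ] _)) ⟩
  countᵇ (v ≡ᵇ_) ((seen ++ [ x ]) ++ discardThirdGo (seen ++ [ x ]) xs)
    ≡⟨ countᵇ-discardThirdGo (seen ++ [ x ]) xs seen′≤2 v ⟩
  2 ⊓ (countᵇ (v ≡ᵇ_) (seen ++ [ x ]) + countᵇ (v ≡ᵇ_) xs)
    ≡⟨ cong (λ c → 2 ⊓ (c + countᵇ (v ≡ᵇ_) xs)) (countᵇ-∷ʳ (v ≡ᵇ_) seen x) ⟩
  2 ⊓ (countᵇ (v ≡ᵇ_) seen + bit (v ≡ᵇ x) + countᵇ (v ≡ᵇ_) xs)
    ≡⟨ cong (2 ⊓_) (+-assoc (countᵇ (v ≡ᵇ_) seen) _ _) ⟩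
  2 ⊓ (countᵇ (v ≡ᵇ_) seen + countᵇ (v ≡ᵇ_) (x ∷ xs)) ∎
  where
  open ≡-Reasoning
  seen′≤2 : ∀ w → countᵇ (w ≡ᵇ_) (seen ++ [ x ]) ≤ 2
  seen′≤2 w rewrite countᵇ-∷ʳ (w ≡ᵇ_) seen x with w ≟ x
  ... | yes refl = +-monoˡ-≤ 1 (<ᵇ2⇒≤1 (trans (cong (_<ᵇ 2) (sym (occurrences≡countᵇ w seen))) fresh))
  ... | no _     = ≤-trans (≤-reflexive (+-identityʳ _)) (seen≤2 w)
... | false with v ≟ x
...   | no _     = countᵇ-discardThirdGo seen xs seen≤2 v
...   | yes refl = trans (countᵇ-discardThirdGo seen xs seen≤2 v)
                         (trans (saturated _) (sym (saturated _)))
  where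
  twice : 2 ≤ countᵇ (v ≡ᵇ_) seen
  twice = ≮ᵇ2⇒2≤ (trans (cong (_<ᵇ 2) (sym (occurrences≡countᵇ v seen))) fresh)
  saturated : ∀ c → 2 ⊓ (countᵇ (v ≡ᵇ_) seen + c) ≡ 2
  saturated c = m≤n⇒m⊓n≡m (≤-trans twice (m≤m+n _ c))

countᵇ-discardThird : (xs : List (Fin m)) (v : Fin m) → countᵇ (v ≡ᵇ_) (discardThird xs) ≡ 2 ⊓ countᵇ (v ≡ᵇ_) xs
countᵇ-discardThird xs = countᵇ-discardThirdGo [] xs (λ _ → z≤n)

discardThirdGo-++ : (seen xs ys : List (Fin m)) →
  discardThirdGo seen (xs ++ ys) ≡ discardThirdGo seen xs ++ discardThirdGo (seen ++ discardThirdGo seen xs) ys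
discardThirdGo-++ seen []       ys rewrite ++-identityʳ seen = refl
discardThirdGo-++ seen (x ∷ xs) ys with occurrences x seen <ᵇ 2
... | true  rewrite discardThirdGo-++ (seen ++ [ x ]) xs ys
                  | ++-assoc seen [ x ] (discardThirdGo (seen ++ [ x ]) xs) = refl
... | false = discardThirdGo-++ seen xs ys

discardThird-∷ʳ-third : (xs : List (Fin m)) (x : Fin m) → 2 ≤ countᵇ (x ≡ᵇ_) xs →
                        discardThird (xs ++ [ x ]) ≡ discardThird xs
discardThird-∷ʳ-third xs x twice rewrite discardThirdGo-++ [] xs [ x ]
  with occurrences x (discardThird xs) <ᵇ 2 in fresh
... | false = ++-identityʳ _
... | true  = ⊥-elim (<⇒≱ (s≤s (<ᵇ2⇒≤1 fresh)) (≤-reflexive kept-twice))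
  where
  kept-twice : 2 ≡ occurrences x (discardThird xs)
  kept-twice = sym (trans (occurrences≡countᵇ x (discardThird xs))
                          (trans (countᵇ-discardThird xs x) (m≤n⇒m⊓n≡m twice)))

discardThirdBy : (Fin k → Fin m) → List (Fin m) → List (Fin k) → List (Fin k)
discardThirdBy f seen []       = []
discardThirdBy f seen (c ∷ cs) =
  if occurrences (f c) seen <ᵇ 2
    then c ∷ discardThirdBy f (seen ++ [ f c ]) cs
    else discardThirdBy f seen cs

module _ (f : Fin k → Fin m) where

  map-discardThirdBy : ∀ seen cs → map f (discardThirdBy f seen cs) ≡ discardThirdGo seen (map f cs)
  map-discardThirdBy seen []       = refl
  map-discardThirdBy seen (c ∷ cs) with occurrences (f c) seen <ᵇ 2
  ... | true  = cong (f c ∷_) (map-discardThirdBy (seen ++ [ f c ]) cs)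
  ... | false = map-discardThirdBy seen cs

  ∈ᵇ-discardThirdBy⁻ : ∀ seen cs {x} → x ∈ᵇ discardThirdBy f seen cs ≡ true → x ∈ᵇ cs ≡ true
  ∈ᵇ-discardThirdBy⁻ seen (c ∷ cs) {x} x∈ with occurrences (f c) seen <ᵇ 2
  ... | false = ∨-introʳ (x ≡ᵇ c) (∈ᵇ-discardThirdBy⁻ seen cs x∈)
  ... | true with ∈ᵇ-∷⁻ (discardThirdBy f (seen ++ [ f c ]) cs) x∈
  ...   | inj₁ refl = ∨-introˡ _ (≡ᵇ-refl x)
  ...   | inj₂ x∈′  = ∨-introʳ (x ≡ᵇ c) (∈ᵇ-discardThirdBy⁻ (seen ++ [ f c ]) cs x∈′)

  Unique-discardThirdBy : ∀ seen cs → Unique cs → Unique (discardThirdBy f seen cs)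
  Unique-discardThirdBy seen []       _          = _
  Unique-discardThirdBy seen (c ∷ cs) (c∉cs , u) with occurrences (f c) seen <ᵇ 2
  ... | false = Unique-discardThirdBy seen cs u
  ... | true  = c∉ , Unique-discardThirdBy (seen ++ [ f c ]) cs u
    where
    c∉ : c ∈ᵇ discardThirdBy f (seen ++ [ f c ]) cs ≡ false
    c∉ with c ∈ᵇ discardThirdBy f (seen ++ [ f c ]) cs in c∈
    ... | false = refl
    ... | true with () ← trans (sym c∉cs) (∈ᵇ-discardThirdBy⁻ _ cs c∈)

2≤ᵇ⇒2≤ : ∀ {a} → (2 ≤ᵇ a) ≡ true → 2 ≤ a
2≤ᵇ⇒2≤ {suc (suc a)} _ = s≤s (s≤s z≤n)

2≤⇒2≤ᵇ : ∀ {a} → 2 ≤ a → (2 ≤ᵇ a) ≡ true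
2≤⇒2≤ᵇ (s≤s (s≤s _)) = refl

isDoublet : List (Fin m) → Fin m → Bool
isDoublet xs x = 2 ≤ᵇ countᵇ (x ≡ᵇ_) xs

doublets≡countᵇ : (xs : List (Fin m)) → doublets xs ≡ countᵇ (isDoublet xs) (allFin m)
doublets≡countᵇ {m} xs =
  trans (length-filterᵇ _ (allFin m)) (countᵇ-cong (λ x → cong (2 ≤ᵇ_) (occurrences≡countᵇ x xs)) (allFin m))

countᵇ-take : (k : ℕ) (p : A → Bool) (xs : List A) → countᵇ p (take k xs) ≤ countᵇ p xs
countᵇ-take zero    p xs       = z≤n
countᵇ-take (suc k) p []       = z≤n
countᵇ-take (suc k) p (x ∷ xs) = +-monoʳ-≤ (bit (p x)) (countᵇ-take k p xs)

isDoublet-take : (k : ℕ) (xs : List (Fin m)) {x : Fin m} → isDoublet (take k xs) x ≡ true → isDoublet xs x ≡ true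
isDoublet-take k xs {x} d = 2≤⇒2≤ᵇ (≤-trans (2≤ᵇ⇒2≤ d) (countᵇ-take k (x ≡ᵇ_) xs))

isDoublet-++ : (xs ys : List (Fin m)) {x : Fin m} → isDoublet xs x ≡ true → isDoublet (xs ++ ys) x ≡ true
isDoublet-++ xs ys {x} d =
  2≤⇒2≤ᵇ (≤-trans (2≤ᵇ⇒2≤ d) (≤-trans (m≤m+n (countᵇ (x ≡ᵇ_) xs) _)
                                      (≤-reflexive (sym (countᵇ-++ (x ≡ᵇ_) xs ys)))))

doublets-take-≤ : (k : ℕ) (xs : List (Fin m)) → doublets (take k xs) ≤ doublets xs
doublets-take-≤ {m} k xs rewrite doublets≡countᵇ (take k xs) | doublets≡countᵇ xs =
  countᵇ-mono (λ x → isDoublet-take k xs) (allFin m)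

-- Rooted trees and leaf removal

iter-suc : (f : A → A) (k : ℕ) (x : A) → iter f (suc k) x ≡ iter f k (f x)
iter-suc f zero    x = refl
iter-suc f (suc k) x = cong f (iter-suc f k x)

iter-fixed : (f : A → A) {x : A} → f x ≡ x → ∀ k → iter f k x ≡ x
iter-fixed f fx≡x zero    = refl
iter-fixed f fx≡x (suc k) = trans (cong f (iter-fixed f fx≡x k)) fx≡x

module _ {n : ℕ} (T : RootedTree n) where
  open RootedTree T

  isNonRoot : Fin n → Bool
  isNonRoot v = not (isRoot T v)

  isNonRoot⇒≢root : ∀ {v} → isNonRoot v ≡ true → v ≢ root
  isNonRoot⇒≢root {v} nonRoot refl rewrite ≡ᵇ-refl v with () ← nonRoot

  ≢root⇒isNonRoot : ∀ {v} → v ≢ root → isNonRoot v ≡ true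
  ≢root⇒isNonRoot v≢root rewrite ≢⇒≡ᵇ-false v≢root = refl

  parent-≢ : ∀ {c} → isNonRoot c ≡ true → parent c ≢ c
  parent-≢ {c} nonRoot fixed with reaches c
  ... | k , reach = isNonRoot⇒≢root nonRoot (trans (sym (iter-fixed parent fixed k)) reach)

  isChild-parent : ∀ {c} → isNonRoot c ≡ true → isChild T c (parent c) ≡ true
  isChild-parent {c} nonRoot rewrite nonRoot = ≡ᵇ-refl (parent c)

  isChild⇒ : ∀ {c v} → isChild T c v ≡ true → isNonRoot c ≡ true × parent c ≡ v
  isChild⇒ child = ∧-conicalˡ _ _ child , ≡ᵇ⇒≡ (∧-conicalʳ _ _ child)

  rootDistance : (v : Fin n) →
    Σ ℕ λ k → iter parent k v ≡ᵇ root ≡ true × (∀ j → j < k → iter parent j v ≡ᵇ root ≡ false)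
  rootDistance v with reaches v
  ... | K , reach = least-witness (λ k → iter parent k v ≡ᵇ root) K (trans (cong (_≡ᵇ root) reach) (≡ᵇ-refl root))

  depth : Fin n → ℕ
  depth v = proj₁ (rootDistance v)

  depth-parent< : ∀ {c} → isNonRoot c ≡ true → depth (parent c) < depth c
  depth-parent< {c} nonRoot with rootDistance c | rootDistance (parent c)
  ... | zero  , atRoot , _ | _ = ⊥-elim (isNonRoot⇒≢root nonRoot (≡ᵇ⇒≡ atRoot))
  ... | suc d , atRoot , _ | d′ , _ , below with d′ ≤? d
  ...   | yes d′≤d = s≤s d′≤d
  ...   | no d′≰d with () ← trans (sym (below d (≰⇒> d′≰d)))
                                   (trans (cong (_≡ᵇ root) (sym (iter-suc parent d c))) atRoot)

  sumBy-children : (q : Fin n → Bool) →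
    sumBy (λ v → countᵇ q (children T v)) (allFin n) ≡ countᵇ (λ c → isNonRoot c ∧ q c) (allFin n)
  sumBy-children q = begin
    sumBy (λ v → countᵇ q (children T v)) (allFin n)
      ≡⟨ sumBy-cong (λ v → countᵇ-filterᵇ (λ c → isChild T c v) q (allFin n)) (allFin n) ⟩
    sumBy (λ v → sumBy (λ c → bit (isChild T c v ∧ q c)) (allFin n)) (allFin n)
      ≡⟨ sumBy-swap (λ v c → bit (isChild T c v ∧ q c)) (allFin n) (allFin n) ⟩
    sumBy (λ c → countᵇ (λ v → isChild T c v ∧ q c) (allFin n)) (allFin n)
      ≡⟨ sumBy-cong (λ c → trans (countᵇ-cong (reorder c) (allFin n))
                                 (countᵇ-allFin-≡ᵇ (parent c) (λ _ → isNonRoot c ∧ q c))) (allFin n) ⟩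
    countᵇ (λ c → isNonRoot c ∧ q c) (allFin n) ∎
    where
    open ≡-Reasoning
    reorder : ∀ c v → isChild T c v ∧ q c ≡ v ≡ᵇ parent c ∧ (isNonRoot c ∧ q c)
    reorder c v rewrite ≡ᵇ-sym (parent c) v with isNonRoot c | v ≡ᵇ parent c
    ... | false | false = refl
    ... | false | true  = refl
    ... | true  | false = refl
    ... | true  | true  = refl

  countᵇ≡sumBy-children : (q : Fin n → Bool) → q root ≡ false →
                          countᵇ q (allFin n) ≡ sumBy (λ v → countᵇ q (children T v)) (allFin n)
  countᵇ≡sumBy-children q q-root = trans (countᵇ-cong nonRoot-only (allFin n)) (sym (sumBy-children q))
    where
    nonRoot-only : ∀ c → q c ≡ isNonRoot c ∧ q c
    nonRoot-only c with c ≟ root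
    ... | yes refl = q-root
    ... | no _     = refl

  ChildrenFirst : List (Fin n) → Set
  ChildrenFirst []       = ⊤
  ChildrenFirst (x ∷ xs) = (∀ {y} → y ∈ᵇ xs ≡ true → parent y ≢ x) × ChildrenFirst xs

  ChildrenFirst-∷ʳ : ∀ xs {v} → ChildrenFirst xs → parent v ∈ᵇ xs ≡ false → ChildrenFirst (xs ++ [ v ])
  ChildrenFirst-∷ʳ []       _                  _ = (λ ()) , _
  ChildrenFirst-∷ʳ (x ∷ xs) {v} (x-first , cf) pv∉ = x-first′ , ChildrenFirst-∷ʳ xs cf (∨-conicalʳ _ _ pv∉)
    where
    x-first′ : ∀ {y} → y ∈ᵇ (xs ++ [ v ]) ≡ true → parent y ≢ x
    x-first′ y∈ with ∈ᵇ-∷ʳ⁻ xs y∈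
    ... | inj₁ y∈xs = x-first y∈xs
    ... | inj₂ refl = ≡ᵇ-false⇒≢ (∨-conicalˡ _ _ pv∉)

  -- In a children-first list the parent of c comes after c.
  parent-of-last : (p : Fin n → Bool) → ∀ xs → ChildrenFirst xs → ∀ ys {c} → filterᵇ p xs ≡ ys ++ [ c ] →
                   isNonRoot c ≡ true → parent c ∈ᵇ xs ≡ true → p (parent c) ≡ false
  parent-of-last p xs cf ys {c} last c-nonRoot pc∈ with p (parent c) in ppc
  ... | false = refl
  ... | true  = ⊥-elim (go xs cf ys last pc∈)
    where
    go : ∀ xs → ChildrenFirst xs → ∀ ys → filterᵇ p xs ≡ ys ++ [ c ] → parent c ∈ᵇ xs ≡ true → ⊥
    go (y ∷ xs) (y-first , cf) ys last pc∈ with p y in py | ∈ᵇ-∷⁻ xs pc∈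
    ... | false | inj₁ refl with () ← trans (sym py) ppc
    ... | false | inj₂ pc∈′ = go xs cf ys last pc∈′
    go (y ∷ xs) (y-first , cf) [] last pc∈ | true | inj₁ refl =
      parent-≢ c-nonRoot (∷-injectiveˡ last)
    go (y ∷ xs) (y-first , cf) [] last pc∈ | true | inj₂ pc∈′ with () ←
      trans (sym (cong (parent c ∈ᵇ_) (∷-injectiveʳ last))) (∈ᵇ-filterᵇ⁺ p xs pc∈′ ppc)
    go (y ∷ xs) (y-first , cf) (z ∷ ys) last pc∈ | true | inj₁ refl =
      y-first (proj₁ (∈ᵇ-filterᵇ⁻ p xs (trans (cong (c ∈ᵇ_) (∷-injectiveʳ last)) (∈ᵇ-∷ʳ⁺ʳ c ys)))) refl
    go (y ∷ xs) (y-first , cf) (z ∷ ys) last pc∈ | true | inj₂ pc∈′ = go xs cf ys (∷-injectiveʳ last) pc∈′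

  record ValidRemoval (xs : List (Fin n)) : Set where
    field
      unique        : Unique xs
      nonRoot       : ∀ {x} → x ∈ᵇ xs ≡ true → isNonRoot x ≡ true
      closed        : ∀ {x c} → x ∈ᵇ xs ≡ true → isChild T c x ≡ true → c ∈ᵇ xs ≡ true
      childrenFirst : ChildrenFirst xs

  isCurrentLeaf⁻ : ∀ xs {v} → isCurrentLeaf T xs v ≡ true →
                   isNonRoot v ≡ true × v ∈ᵇ xs ≡ false × (∀ {c} → isChild T c v ≡ true → c ∈ᵇ xs ≡ true)
  isCurrentLeaf⁻ xs {v} leaf with isNonRoot v | v ∈ᵇ xs
  ... | true | false = refl , refl , all-filterᵇ⁻ (_∈ᵇ xs) (λ c → isChild T c v) leaf (∈-allFin _)

  isCurrentLeaf⁺ : ∀ xs {v} → isNonRoot v ≡ true → v ∈ᵇ xs ≡ false →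
                   (∀ c → isChild T c v ≡ true → c ∈ᵇ xs ≡ true) → isCurrentLeaf T xs v ≡ true
  isCurrentLeaf⁺ xs {v} nonRoot v∉ childrenGone rewrite nonRoot | v∉ =
    all-filterᵇ⁺ (_∈ᵇ xs) (λ c → isChild T c v) childrenGone (allFin n)

  ValidRemoval-∷ʳ : ∀ {xs v} → ValidRemoval xs → isCurrentLeaf T xs v ≡ true → ValidRemoval (xs ++ [ v ])
  ValidRemoval-∷ʳ {xs} {v} valid leaf = record
    { unique        = Unique-∷ʳ xs unique v∉
    ; nonRoot       = nonRoot′
    ; closed        = closed′
    ; childrenFirst = ChildrenFirst-∷ʳ xs childrenFirst pv∉
    }
    where
    open ValidRemoval valid
    v-nonRoot : isNonRoot v ≡ true
    v-nonRoot = proj₁ (isCurrentLeaf⁻ xs leaf)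
    v∉ : v ∈ᵇ xs ≡ false
    v∉ = proj₁ (proj₂ (isCurrentLeaf⁻ xs leaf))
    childrenGone : ∀ {c} → isChild T c v ≡ true → c ∈ᵇ xs ≡ true
    childrenGone = proj₂ (proj₂ (isCurrentLeaf⁻ xs leaf))
    nonRoot′ : ∀ {x} → x ∈ᵇ (xs ++ [ v ]) ≡ true → isNonRoot x ≡ true
    nonRoot′ x∈ with ∈ᵇ-∷ʳ⁻ xs x∈
    ... | inj₁ x∈xs = nonRoot x∈xs
    ... | inj₂ refl = v-nonRoot
    closed′ : ∀ {x c} → x ∈ᵇ (xs ++ [ v ]) ≡ true → isChild T c x ≡ true → c ∈ᵇ (xs ++ [ v ]) ≡ true
    closed′ x∈ child with ∈ᵇ-∷ʳ⁻ xs x∈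
    ... | inj₁ x∈xs = ∈ᵇ-∷ʳ⁺ˡ v xs (closed x∈xs child)
    ... | inj₂ refl = ∈ᵇ-∷ʳ⁺ˡ v xs (childrenGone child)
    pv∉ : parent v ∈ᵇ xs ≡ false
    pv∉ with parent v ∈ᵇ xs in pv∈
    ... | false = refl
    ... | true with () ← trans (sym v∉) (closed pv∈ (isChild-parent v-nonRoot))

  -- A deepest vertex that is still present is a current leaf.
  smallestLeaf-exists : ∀ xs {w} → isNonRoot w ≡ true → w ∈ᵇ xs ≡ false →
                        Σ (Fin n) λ v → smallestLeaf T xs ≡ just v × isCurrentLeaf T xs v ≡ true
  smallestLeaf-exists xs {w} w-nonRoot w∉ =
    head-filterᵇ (isCurrentLeaf T xs) (∈-allFin deepest)
      (isCurrentLeaf⁺ xs (∧-conicalˡ _ _ deepest-present) deepest∉ childrenGone)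
    where
    present : Fin n → Bool
    present u = isNonRoot u ∧ not (u ∈ᵇ xs)
    weight : Fin n → ℕ
    weight u = if present u then suc (depth u) else 0
    deepest : Fin n
    deepest = argmax weight w (allFin n)
    maximal : ∀ u → weight u ≤ weight deepest
    maximal u = All.lookup (f[xs]≤f[argmax] {f = weight} w (allFin n)) (∈-allFin u)
    present⁺ : ∀ {u} → isNonRoot u ≡ true → u ∈ᵇ xs ≡ false → present u ≡ true
    present⁺ nonRoot u∉ rewrite nonRoot | u∉ = refl
    deepest-present : present deepest ≡ true
    deepest-present with present deepest in pd
    ... | true  = refl
    ... | false = ⊥-elim (≤⇒≯ (subst (λ b → weight w ≤ (if b then suc (depth deepest) else 0)) pd
                                      (f[⊥]≤f[argmax] {f = weight} w (allFin n)))
                              (subst (λ b → 0 < (if b then suc (depth w) else 0)) (sym (present⁺ w-nonRoot w∉)) z<s))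
    deepest∉ : deepest ∈ᵇ xs ≡ false
    deepest∉ = trans (sym (not-involutive _)) (cong not (∧-conicalʳ (isNonRoot deepest) _ deepest-present))
    childrenGone : ∀ c → isChild T c deepest ≡ true → c ∈ᵇ xs ≡ true
    childrenGone c child with isChild⇒ child | c ∈ᵇ xs in c∈
    ... | _        , _    | true  = refl
    ... | c-nonRoot , pc≡deepest | false = ⊥-elim (≤⇒≯ (maximal c) deeper)
      where
      deeper : weight deepest < weight c
      deeper rewrite deepest-present | present⁺ c-nonRoot c∈ =
        s≤s (subst (λ u → depth u < depth c) pc≡deepest (depth-parent< c-nonRoot))

  nonRootCount≡n∸1 : countᵇ isNonRoot (allFin n) ≡ n ∸ 1
  nonRootCount≡n∸1 = cong (_∸ 1) vertexCount
    where
    open ≡-Reasoning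
    vertexCount : 1 + countᵇ isNonRoot (allFin n) ≡ n
    vertexCount = begin
      1 + countᵇ isNonRoot (allFin n)
        ≡⟨ cong (_+ countᵇ isNonRoot (allFin n)) (sym (countᵇ-allFin-≡ᵇ root (λ _ → true))) ⟩
      countᵇ (λ v → v ≡ᵇ root ∧ true) (allFin n) + countᵇ isNonRoot (allFin n)
        ≡⟨ cong (_+ countᵇ isNonRoot (allFin n)) (countᵇ-cong (λ v → ∧-identityʳ (v ≡ᵇ root)) (allFin n)) ⟩
      countᵇ (isRoot T) (allFin n) + countᵇ isNonRoot (allFin n)
        ≡⟨ sym (countᵇ-split (λ _ → true) (isRoot T) (allFin n)) ⟩
      countᵇ (λ _ → true) (allFin n)
        ≡⟨ countᵇ-true (allFin n) ⟩
      length (allFin n)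
        ≡⟨ length-tabulate id ⟩
      n ∎

  removeLeaves-valid : ∀ k xs → ValidRemoval xs → length xs + k ≡ countᵇ isNonRoot (allFin n) →
    ValidRemoval (removeLeaves T k xs) × length (removeLeaves T k xs) ≡ countᵇ isNonRoot (allFin n)
  removeLeaves-valid zero    xs valid len = valid , trans (sym (+-identityʳ _)) len
  removeLeaves-valid (suc k) xs valid len
    with countᵇ<⇒witness (_∈ᵇ xs) isNonRoot (allFin n) someLeft
    where
    someLeft : countᵇ (_∈ᵇ xs) (allFin n) < countᵇ isNonRoot (allFin n)
    someLeft rewrite countᵇ-allFin-∈ᵇ≡length xs (ValidRemoval.unique valid) =
      ≤-trans (s≤s (m≤m+n (length xs) k)) (≤-reflexive (trans (sym (+-suc (length xs) k)) len))
  ... | w , w-nonRoot , w∉ with smallestLeaf T xs | smallestLeaf-exists xs w-nonRoot w∉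
  ...   | .(just v) | v , refl , leaf =
    removeLeaves-valid k (xs ++ [ v ]) (ValidRemoval-∷ʳ valid leaf)
      (trans (cong (_+ k) (length-++ xs)) (trans (+-assoc (length xs) 1 k) len))

  private
    removalOrder-valid-length : ValidRemoval (removalOrder T) × length (removalOrder T) ≡ countᵇ isNonRoot (allFin n)
    removalOrder-valid-length = removeLeaves-valid (n ∸ 1) [] empty (sym nonRootCount≡n∸1)
      where
      empty : ValidRemoval []
      empty = record { unique = _ ; nonRoot = λ () ; closed = λ () ; childrenFirst = _ }

  removalOrder-valid : ValidRemoval (removalOrder T)
  removalOrder-valid = proj₁ removalOrder-valid-length

  private module Order = ValidRemoval removalOrder-valid

  isNonRoot⇒∈ᵇ-removalOrder : ∀ {v} → isNonRoot v ≡ true → v ∈ᵇ removalOrder T ≡ true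
  isNonRoot⇒∈ᵇ-removalOrder {v} = countᵇ-mono-tight (λ _ → Order.nonRoot) allRemoved (∈-allFin v)
    where
    allRemoved : countᵇ isNonRoot (allFin n) ≤ countᵇ (_∈ᵇ removalOrder T) (allFin n)
    allRemoved = ≤-reflexive (trans (sym (proj₂ removalOrder-valid-length)) (sym (countᵇ-allFin-∈ᵇ≡length _ Order.unique)))

  ∈ᵇ-removalOrder : ∀ v → v ∈ᵇ removalOrder T ≡ isNonRoot v
  ∈ᵇ-removalOrder v with v ∈ᵇ removalOrder T in v∈ | isNonRoot v in v-nonRoot
  ... | true  | true  = refl
  ... | false | false = refl
  ... | true  | false = trans (sym (Order.nonRoot v∈)) v-nonRoot
  ... | false | true  = trans (sym v∈) (isNonRoot⇒∈ᵇ-removalOrder v-nonRoot)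

  countᵇ-removalOrder : (q : Fin n → Bool) → countᵇ q (removalOrder T) ≡ countᵇ (λ c → isNonRoot c ∧ q c) (allFin n)
  countᵇ-removalOrder q =
    trans (sym (countᵇ-allFin-∈ᵇ q (removalOrder T) Order.unique))
          (countᵇ-cong (λ c → cong (_∧ q c) (∈ᵇ-removalOrder c)) (allFin n))

-- P-positions, the slither code and path-collections

module _ {n : ℕ} (T : RootedTree n) (P : Fin n → Bool) (cls : IsPNClassification T P) where
  open RootedTree T

  pChildren : Fin n → ℕ
  pChildren = countChildren T P

  P-position⇒pChildren≤1 : ∀ {v} → P v ≡ true → pChildren v ≤ 1
  P-position⇒pChildren≤1 {v} = Equivalence.to (cls v)

  N-position⇒2≤pChildren : ∀ {v} → P v ≡ false → 2 ≤ pChildren v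
  N-position⇒2≤pChildren {v} Pv with 2 ≤? pChildren v
  ... | yes 2≤ = 2≤
  ... | no 2≰  with () ← trans (sym Pv) (Equivalence.from (cls v) (≤-pred (≰⇒> 2≰)))

  2≤ᵇpChildren : ∀ v → (2 ≤ᵇ pChildren v) ≡ not (P v)
  2≤ᵇpChildren v with P v in Pv
  ... | false = 2≤⇒2≤ᵇ (N-position⇒2≤pChildren Pv)
  ... | true with 2 ≤ᵇ pChildren v in 2≤
  ...   | false = refl
  ...   | true  = ⊥-elim (<⇒≱ (s≤s (P-position⇒pChildren≤1 Pv)) (2≤ᵇ⇒2≤ 2≤))

  pPositions : List (Fin n)
  pPositions = filterᵇ P (removalOrder T)

  fillSlots-prefix : ∀ vs l r → Σ (List (Fin n)) λ R → fillSlots T P vs l r ≡ reverse l ++ (filterᵇ P vs ++ R)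
  fillSlots-prefix []       l r = r , refl
  fillSlots-prefix (v ∷ vs) l r with P v
  ... | false = fillSlots-prefix vs l (v ∷ r)
  ... | true with fillSlots-prefix vs (v ∷ l) r
  ...   | R , eq = R , trans eq (trans (cong (_++ (filterᵇ P vs ++ R)) (unfold-reverse v l))
                                       (++-assoc (reverse l) [ v ] _))

  take-slitherCode : ∀ {γ} → γ ≤ length pPositions → take γ (slitherCode T P) ≡ take γ (map parent pPositions)
  take-slitherCode {γ} γ≤ with fillSlots-prefix (removalOrder T) [] []
  ... | R , eq rewrite eq | map-++ parent pPositions R =
    take-++ˡ γ (map parent pPositions) (map parent R) (≤-trans γ≤ (≤-reflexive (sym (length-map parent pPositions))))

  countᵇ-parents : ∀ v → countᵇ (v ≡ᵇ_) (map parent pPositions) ≡ pChildren v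
  countᵇ-parents v = begin
    countᵇ (v ≡ᵇ_) (map parent pPositions)                        ≡⟨ countᵇ-map (v ≡ᵇ_) parent pPositions ⟩
    countᵇ (λ c → v ≡ᵇ parent c) pPositions                       ≡⟨ countᵇ-filterᵇ P _ (removalOrder T) ⟩
    countᵇ (λ c → P c ∧ v ≡ᵇ parent c) (removalOrder T)           ≡⟨ countᵇ-removalOrder T _ ⟩
    countᵇ (λ c → isNonRoot T c ∧ (P c ∧ v ≡ᵇ parent c)) (allFin n) ≡⟨ countᵇ-cong reorder (allFin n) ⟩
    countᵇ (λ c → isChild T c v ∧ P c) (allFin n)                 ≡⟨ sym (countᵇ-filterᵇ _ P (allFin n)) ⟩
    countᵇ P (children T v)                                       ≡⟨ sym (length-filterᵇ P (children T v)) ⟩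
    pChildren v                                                   ∎
    where
    open ≡-Reasoning
    reorder : ∀ c → isNonRoot T c ∧ (P c ∧ v ≡ᵇ parent c) ≡ isChild T c v ∧ P c
    reorder c rewrite ≡ᵇ-sym v (parent c) with isNonRoot T c | P c | parent c ≡ᵇ v
    ... | false | _     | _     = refl
    ... | true  | false | false = refl
    ... | true  | false | true  = refl
    ... | true  | true  | b     = sym (∧-identityʳ b)

  doublets-parents : doublets (map parent pPositions) ≡ countᵇ (not ∘ P) (allFin n)
  doublets-parents =
    trans (doublets≡countᵇ (map parent pPositions))
          (countᵇ-cong (λ v → trans (cong (2 ≤ᵇ_) (countᵇ-parents v)) (2≤ᵇpChildren v)) (allFin n))

  capacity : ℕ
  capacity = sumBy (λ v → 2 ⊓ pChildren v) (allFin n)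

  inE-root : ∀ {E} → IsPathCollection T E → inE T E root ≡ false
  inE-root (root∉ , _) = cong isInside root∉

  childEdges+parentEdge≤2 : ∀ {E} → IsPathCollection T E → ∀ v →
                            countᵇ (inE T E) (children T v) + bit (inE T E v) ≤ 2
  childEdges+parentEdge≤2 {E} (_ , degree≤2) v =
    subst (λ k → k + bit (inE T E v) ≤ 2) (length-filterᵇ (inE T E) (children T v)) (degree≤2 v)

  module _ {E : Subset n} (path : IsPathCollection T E) where
    private
      edge : Fin n → Bool
      edge = inE T E
      nEdge : Fin n → Bool
      nEdge c = edge c ∧ not (P c)

    pEdges≤ : ∀ v → countᵇ (λ c → edge c ∧ P c) (children T v) ≤ 2 ⊓ pChildren v
    pEdges≤ v = ⊓-glb (≤-trans (countᵇ-mono (λ c → ∧-conicalˡ _ _) (children T v))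
                               (≤-trans (m≤m+n _ _) (childEdges+parentEdge≤2 {E} path v)))
                      (≤-trans (countᵇ-mono (λ c → ∧-conicalʳ _ _) (children T v))
                               (≤-reflexive (sym (length-filterᵇ P (children T v)))))

    childEdges≤ : ∀ v → countᵇ edge (children T v) ≤ 2 ⊓ pChildren v + countᵇ nEdge (children T v)
    childEdges≤ v = begin
      countᵇ edge (children T v)
        ≡⟨ countᵇ-split edge P (children T v) ⟩
      countᵇ (λ c → edge c ∧ P c) (children T v) + countᵇ nEdge (children T v)
        ≤⟨ +-monoˡ-≤ _ (pEdges≤ v) ⟩
      2 ⊓ pChildren v + countᵇ nEdge (children T v) ∎
      where open ≤-Reasoning

    -- An edge from an N-position to its parent leaves room for only one
    -- child edge, and an N-position has at least two P-children.
    vertex-bound : ∀ v → countᵇ edge (children T v) + bit (nEdge v) ≤ 2 ⊓ pChildren v + countᵇ nEdge (children T v)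
    vertex-bound v with edge v in ev | P v in Pv
    ... | true | false = begin
      countᵇ edge (children T v) + 1             ≡⟨ cong (λ b → countᵇ edge (children T v) + bit b) (sym ev) ⟩
      countᵇ edge (children T v) + bit (edge v)  ≤⟨ childEdges+parentEdge≤2 {E} path v ⟩
      2                                          ≡⟨ sym (m≤n⇒m⊓n≡m (N-position⇒2≤pChildren Pv)) ⟩
      2 ⊓ pChildren v                            ≤⟨ m≤m+n _ _ ⟩
      2 ⊓ pChildren v + countᵇ nEdge (children T v) ∎
      where open ≤-Reasoning
    ... | true  | true = ≤-trans (≤-reflexive (+-identityʳ _)) (childEdges≤ v)
    ... | false | _    = ≤-trans (≤-reflexive (+-identityʳ _)) (childEdges≤ v)

    ∣E∣≤capacity : ∣ E ∣ ≤ capacity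
    ∣E∣≤capacity = +-cancelʳ-≤ (countᵇ nEdge (allFin n)) ∣ E ∣ capacity (begin
      ∣ E ∣ + countᵇ nEdge (allFin n)
        ≡⟨ cong (_+ countᵇ nEdge (allFin n)) (trans (∣∣≡countᵇ E) (countᵇ≡sumBy-children T edge (inE-root {E} path))) ⟩
      sumBy (λ v → countᵇ edge (children T v)) (allFin n) + countᵇ nEdge (allFin n)
        ≡⟨ sym (sumBy-+ (λ v → countᵇ edge (children T v)) (bit ∘ nEdge) (allFin n)) ⟩
      sumBy (λ v → countᵇ edge (children T v) + bit (nEdge v)) (allFin n)
        ≤⟨ sumBy-mono vertex-bound (allFin n) ⟩
      sumBy (λ v → 2 ⊓ pChildren v + countᵇ nEdge (children T v)) (allFin n)
        ≡⟨ sumBy-+ (λ v → 2 ⊓ pChildren v) (λ v → countᵇ nEdge (children T v)) (allFin n) ⟩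
      capacity + sumBy (λ v → countᵇ nEdge (children T v)) (allFin n)
        ≡⟨ cong (capacity +_) (sym (countᵇ≡sumBy-children T nEdge nEdge-root)) ⟩
      capacity + countᵇ nEdge (allFin n) ∎)
      where
      open ≤-Reasoning
      nEdge-root : nEdge root ≡ false
      nEdge-root = cong (_∧ not (P root)) (inE-root {E} path)

  -- For each vertex keep the edges to its first two P-children in removal order.
  keptEdges : List (Fin n)
  keptEdges = discardThirdBy parent [] pPositions

  keptEdge⇒ : ∀ {c} → c ∈ᵇ keptEdges ≡ true → isNonRoot T c ≡ true × P c ≡ true
  keptEdge⇒ {c} c∈ with ∈ᵇ-filterᵇ⁻ P (removalOrder T) (∈ᵇ-discardThirdBy⁻ parent [] pPositions c∈)
  ... | c∈order , Pc = trans (sym (∈ᵇ-removalOrder T c)) c∈order , Pc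

  Unique-keptEdges : Unique keptEdges
  Unique-keptEdges = Unique-discardThirdBy parent [] pPositions
                       (Unique-filterᵇ P (removalOrder T) (ValidRemoval.unique (removalOrder-valid T)))

  root∉keptEdges : root ∈ᵇ keptEdges ≡ false
  root∉keptEdges with root ∈ᵇ keptEdges in root∈
  ... | false = refl
  ... | true  = ⊥-elim (isNonRoot⇒≢root T (proj₁ (keptEdge⇒ root∈)) refl)

  countᵇ-keptEdges-children : ∀ v → countᵇ (_∈ᵇ keptEdges) (children T v) ≡ 2 ⊓ pChildren v
  countᵇ-keptEdges-children v = begin
    countᵇ (_∈ᵇ keptEdges) (children T v)                         ≡⟨ countᵇ-filterᵇ _ (_∈ᵇ keptEdges) (allFin n) ⟩
    countᵇ (λ c → isChild T c v ∧ c ∈ᵇ keptEdges) (allFin n)      ≡⟨ countᵇ-cong reorder (allFin n) ⟩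
    countᵇ (λ c → c ∈ᵇ keptEdges ∧ v ≡ᵇ parent c) (allFin n)      ≡⟨ countᵇ-allFin-∈ᵇ _ keptEdges Unique-keptEdges ⟩
    countᵇ (λ c → v ≡ᵇ parent c) keptEdges                        ≡⟨ sym (countᵇ-map (v ≡ᵇ_) parent keptEdges) ⟩
    countᵇ (v ≡ᵇ_) (map parent keptEdges)                         ≡⟨ cong (countᵇ (v ≡ᵇ_)) (map-discardThirdBy parent [] pPositions) ⟩
    countᵇ (v ≡ᵇ_) (discardThird (map parent pPositions))         ≡⟨ countᵇ-discardThird (map parent pPositions) v ⟩
    2 ⊓ countᵇ (v ≡ᵇ_) (map parent pPositions)                    ≡⟨ cong (2 ⊓_) (countᵇ-parents v) ⟩
    2 ⊓ pChildren v                                               ∎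
    where
    open ≡-Reasoning
    reorder : ∀ c → isChild T c v ∧ c ∈ᵇ keptEdges ≡ c ∈ᵇ keptEdges ∧ v ≡ᵇ parent c
    reorder c with c ∈ᵇ keptEdges in c∈
    ... | false = ∧-zeroʳ _
    ... | true rewrite proj₁ (keptEdge⇒ c∈) | ≡ᵇ-sym (parent c) v = ∧-identityʳ _

  length-keptEdges : length keptEdges ≡ capacity
  length-keptEdges = begin
    length keptEdges                                                 ≡⟨ sym (countᵇ-allFin-∈ᵇ≡length keptEdges Unique-keptEdges) ⟩
    countᵇ (_∈ᵇ keptEdges) (allFin n)                                ≡⟨ countᵇ≡sumBy-children T _ root∉keptEdges ⟩
    sumBy (λ v → countᵇ (_∈ᵇ keptEdges) (children T v)) (allFin n)   ≡⟨ sumBy-cong countᵇ-keptEdges-children (allFin n) ⟩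
    capacity                                                         ∎
    where open ≡-Reasoning

  keptEdgeSet : Subset n
  keptEdgeSet = Vec.tabulate (_∈ᵇ keptEdges)

  inE-keptEdgeSet : ∀ c → inE T keptEdgeSet c ≡ c ∈ᵇ keptEdges
  inE-keptEdgeSet c = trans (cong isInside (lookup∘tabulate (_∈ᵇ keptEdges) c)) (isInside-id _)

  keptEdgeSet-isPathCollection : IsPathCollection T keptEdgeSet
  keptEdgeSet-isPathCollection = trans (lookup∘tabulate (_∈ᵇ keptEdges) root) root∉keptEdges , degree≤2
    where
    degree≤2 : ∀ v → degreeIn T keptEdgeSet v ≤ 2
    degree≤2 v rewrite length-filterᵇ (inE T keptEdgeSet) (children T v)
                     | countᵇ-cong inE-keptEdgeSet (children T v)
                     | countᵇ-keptEdges-children v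
                     | inE-keptEdgeSet v
      with v ∈ᵇ keptEdges in v∈
    ... | false = ≤-trans (≤-reflexive (+-identityʳ _)) (m⊓n≤m 2 (pChildren v))
    ... | true  = +-monoˡ-≤ 1 (≤-trans (m⊓n≤n 2 (pChildren v)) (P-position⇒pChildren≤1 (proj₂ (keptEdge⇒ v∈))))

  ∣keptEdgeSet∣ : ∣ keptEdgeSet ∣ ≡ capacity
  ∣keptEdgeSet∣ = trans (∣∣≡countᵇ keptEdgeSet)
                        (trans (countᵇ-cong inE-keptEdgeSet (allFin n))
                               (trans (countᵇ-allFin-∈ᵇ≡length keptEdges Unique-keptEdges) length-keptEdges))

  maxPathCollection : IsMaxPathCollectionSize T capacity
  maxPathCollection = (keptEdgeSet , keptEdgeSet-isPathCollection , ∣keptEdgeSet∣) , λ E path → ∣E∣≤capacity {E} path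

  length-discardThird-parents : length (discardThird (map parent pPositions)) ≡ capacity
  length-discardThird-parents =
    trans (cong length (sym (map-discardThirdBy parent [] pPositions)))
          (trans (length-map parent keptEdges) length-keptEdges)

  -- The minimal prefix

  private
    s : List (Fin n)
    s = slitherCode T P
    F : List (Fin n)
    F = pPositions

  nonRootNPositions : ℕ
  nonRootNPositions = countᵇ (λ c → isNonRoot T c ∧ not (P c)) (allFin n)

  nPositions : ℕ
  nPositions = countᵇ (not ∘ P) (allFin n)

  n∸1-split : n ∸ 1 ≡ length F + nonRootNPositions
  n∸1-split = begin
    n ∸ 1                                                              ≡⟨ sym (nonRootCount≡n∸1 T) ⟩
    countᵇ (isNonRoot T) (allFin n)                                    ≡⟨ countᵇ-split (isNonRoot T) P (allFin n) ⟩
    countᵇ (λ c → isNonRoot T c ∧ P c) (allFin n) + nonRootNPositions  ≡⟨ cong (_+ nonRootNPositions) (sym length-F) ⟩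
    length F + nonRootNPositions                                       ∎
    where
    open ≡-Reasoning
    length-F : length F ≡ countᵇ (λ c → isNonRoot T c ∧ P c) (allFin n)
    length-F = trans (length-filterᵇ P (removalOrder T)) (countᵇ-removalOrder T P)

  nPositions-split : nPositions ≡ nonRootNPositions + bit (not (P root))
  nPositions-split = begin
    nPositions
      ≡⟨ countᵇ-split (not ∘ P) (isNonRoot T) (allFin n) ⟩
    countᵇ (λ c → not (P c) ∧ isNonRoot T c) (allFin n) + countᵇ (λ c → not (P c) ∧ not (isNonRoot T c)) (allFin n)
      ≡⟨ cong₂ _+_ (countᵇ-cong (λ c → ∧-comm (not (P c)) (isNonRoot T c)) (allFin n))
                   (trans (countᵇ-cong atRoot (allFin n)) (countᵇ-allFin-≡ᵇ root (not ∘ P))) ⟩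
    nonRootNPositions + bit (not (P root)) ∎
    where
    open ≡-Reasoning
    atRoot : ∀ c → not (P c) ∧ not (isNonRoot T c) ≡ c ≡ᵇ root ∧ not (P c)
    atRoot c rewrite not-involutive (c ≡ᵇ root) = ∧-comm (not (P c)) (c ≡ᵇ root)

  take-length-slitherCode : take (length F) s ≡ map parent F
  take-length-slitherCode =
    trans (take-slitherCode ≤-refl) (take-all (length F) (map parent F) (≤-reflexive (length-map parent F)))

  -- The whole prefix already has n - 1 - |F| doublets, so β cannot exceed |F|.
  β≤length : ∀ {β} → (∀ γ → γ < β → doublets (take γ s) < n ∸ 1 ∸ γ) → β ≤ length F
  β≤length {β} below with length F <? β
  ... | no  F≮β = ≮⇒≥ F≮β
  ... | yes F<β = ⊥-elim (<⇒≱ (below (length F) F<β) enough)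
    where
    enough : n ∸ 1 ∸ length F ≤ doublets (take (length F) s)
    enough = begin
      n ∸ 1 ∸ length F                         ≡⟨ cong (_∸ length F) n∸1-split ⟩
      length F + nonRootNPositions ∸ length F  ≡⟨ m+n∸m≡n (length F) _ ⟩
      nonRootNPositions                        ≤⟨ m≤m+n _ _ ⟩
      nonRootNPositions + bit (not (P root))   ≡⟨ sym nPositions-split ⟩
      nPositions                               ≡⟨ sym doublets-parents ⟩
      doublets (map parent F)                  ≡⟨ cong doublets (sym take-length-slitherCode) ⟩
      doublets (take (length F) s)             ∎
      where open ≤-Reasoning

  n∸1∸β-split : ∀ {β} → β ≤ length F → n ∸ 1 ∸ β ≡ length F ∸ β + nonRootNPositions
  n∸1∸β-split {β} β≤F = trans (cong (_∸ β) n∸1-split) (+-∸-comm nonRootNPositions β≤F)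

  length∸β≤bit : ∀ {β} → β ≤ length F → n ∸ 1 ∸ β ≤ doublets (take β s) → length F ∸ β ≤ bit (not (P root))
  length∸β≤bit {β} β≤F enough = +-cancelʳ-≤ nonRootNPositions _ _ (begin
    length F ∸ β + nonRootNPositions         ≡⟨ sym (n∸1∸β-split β≤F) ⟩
    n ∸ 1 ∸ β                                ≤⟨ enough ⟩
    doublets (take β s)                      ≡⟨ cong doublets (take-slitherCode β≤F) ⟩
    doublets (take β (map parent F))         ≤⟨ doublets-take-≤ β (map parent F) ⟩
    doublets (map parent F)                  ≡⟨ doublets-parents ⟩
    nPositions                               ≡⟨ nPositions-split ⟩
    nonRootNPositions + bit (not (P root))   ≡⟨ +-comm nonRootNPositions _ ⟩
    bit (not (P root)) + nonRootNPositions   ∎)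
    where open ≤-Reasoning

  short-prefix : ∀ {β} → β < length F → n ∸ 1 ∸ β ≤ doublets (take β s) →
                 length F ≡ suc β × P root ≡ false × nPositions ≤ doublets (take β s)
  short-prefix {β} β<F enough with P root in Proot
  ... | true  = ⊥-elim (<⇒≱ (m<n⇒0<n∸m β<F)
                            (≤-trans (length∸β≤bit (<⇒≤ β<F) enough) (≤-reflexive (cong (bit ∘ not) Proot))))
  ... | false = length-F , refl , nPositions≤
    where
    length∸β≡1 : length F ∸ β ≡ 1
    length∸β≡1 = ≤-antisym (≤-trans (length∸β≤bit (<⇒≤ β<F) enough) (≤-reflexive (cong (bit ∘ not) Proot)))
                      (m<n⇒0<n∸m β<F)
    length-F : length F ≡ suc β
    length-F = trans (sym (m∸n+n≡m (<⇒≤ β<F))) (cong (_+ β) length∸β≡1)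
    nPositions≤ : nPositions ≤ doublets (take β s)
    nPositions≤ = begin
      nPositions                               ≡⟨ nPositions-split ⟩
      nonRootNPositions + bit (not (P root))   ≡⟨ cong (λ b → nonRootNPositions + bit (not b)) Proot ⟩
      nonRootNPositions + 1                    ≡⟨ +-comm _ 1 ⟩
      1 + nonRootNPositions                    ≡⟨ cong (_+ nonRootNPositions) (sym length∸β≡1) ⟩
      length F ∸ β + nonRootNPositions         ≡⟨ sym (n∸1∸β-split (<⇒≤ β<F)) ⟩
      n ∸ 1 ∸ β                                ≤⟨ enough ⟩
      doublets (take β s)                      ∎
      where open ≤-Reasoning

  map-parent-∷ʳ : ∀ {F′ c} → F ≡ F′ ++ [ c ] → map parent F ≡ map parent F′ ++ [ parent c ]
  map-parent-∷ʳ {F′} {c} F≡ = trans (cong (map parent) F≡) (map-++ parent F′ [ c ])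

  -- The parent of the last P-position is an N-position, hence a doublet of
  -- the whole prefix, and a shorter prefix with all doublets must contain it twice.
  lastParent-twice : ∀ {F′ c} → F ≡ F′ ++ [ c ] → P root ≡ false → nPositions ≤ doublets (map parent F′) →
                     2 ≤ countᵇ (parent c ≡ᵇ_) (map parent F′)
  lastParent-twice {F′} {c} F≡ Proot enough =
    2≤ᵇ⇒2≤ (countᵇ-mono-tight (λ x → isDoublet-++ (map parent F′) [ parent c ] {x}) tight
                               (∈-allFin (parent c)) parent-doublet)
    where
    c-nonRoot : isNonRoot T c ≡ true
    c-nonRoot = trans (sym (∈ᵇ-removalOrder T c))
                      (proj₁ (∈ᵇ-filterᵇ⁻ P (removalOrder T) (trans (cong (c ∈ᵇ_) F≡) (∈ᵇ-∷ʳ⁺ʳ c F′))))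
    parent-N : P (parent c) ≡ false
    parent-N with parent c ≟ root
    ... | yes pc≡root = trans (cong P pc≡root) Proot
    ... | no  pc≢root = parent-of-last T P (removalOrder T) (ValidRemoval.childrenFirst (removalOrder-valid T))
                          F′ F≡ c-nonRoot (isNonRoot⇒∈ᵇ-removalOrder T (≢root⇒isNonRoot T pc≢root))
    parent-doublet : isDoublet (map parent F′ ++ [ parent c ]) (parent c) ≡ true
    parent-doublet = begin
      isDoublet (map parent F′ ++ [ parent c ]) (parent c)
        ≡⟨ cong (λ xs → isDoublet xs (parent c)) (sym (map-parent-∷ʳ F≡)) ⟩
      2 ≤ᵇ countᵇ (parent c ≡ᵇ_) (map parent F)  ≡⟨ cong (2 ≤ᵇ_) (countᵇ-parents (parent c)) ⟩
      2 ≤ᵇ pChildren (parent c)                   ≡⟨ 2≤ᵇpChildren (parent c) ⟩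
      not (P (parent c))                          ≡⟨ cong not parent-N ⟩
      true                                        ∎
      where open ≡-Reasoning
    tight : countᵇ (isDoublet (map parent F′ ++ [ parent c ])) (allFin n) ≤ countᵇ (isDoublet (map parent F′)) (allFin n)
    tight = begin
      countᵇ (isDoublet (map parent F′ ++ [ parent c ])) (allFin n) ≡⟨ sym (doublets≡countᵇ (map parent F′ ++ [ parent c ])) ⟩
      doublets (map parent F′ ++ [ parent c ])                      ≡⟨ cong doublets (sym (map-parent-∷ʳ F≡)) ⟩
      doublets (map parent F)                                       ≡⟨ doublets-parents ⟩
      nPositions                                                    ≤⟨ enough ⟩
      doublets (map parent F′)                                      ≡⟨ doublets≡countᵇ (map parent F′) ⟩
      countᵇ (isDoublet (map parent F′)) (allFin n)                 ∎
      where open ≤-Reasoning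

  discardThird-minimalPrefix : ∀ β → n ∸ 1 ∸ β ≤ doublets (take β s) →
                               (∀ γ → γ < β → doublets (take γ s) < n ∸ 1 ∸ γ) →
                               discardThird (take β s) ≡ discardThird (map parent F)
  discardThird-minimalPrefix β enough below with m≤n⇒m<n∨m≡n (β≤length below)
  ... | inj₂ refl = cong discardThird take-length-slitherCode
  ... | inj₁ β<F with short-prefix β<F enough | ∷ʳ-decomposition F (≤-trans (s≤s z≤n) β<F)
  ...   | length-F , Proot , nPositions≤ | F′ , c , F≡ = begin
    discardThird (take β s)                       ≡⟨ cong discardThird take-β ⟩
    discardThird (map parent F′)                  ≡⟨ sym (discardThird-∷ʳ-third (map parent F′) (parent c) twice) ⟩
    discardThird (map parent F′ ++ [ parent c ])  ≡⟨ cong discardThird (sym (map-parent-∷ʳ F≡)) ⟩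
    discardThird (map parent F)                   ∎
    where
    open ≡-Reasoning
    length-F′ : length (map parent F′) ≡ β
    length-F′ = trans (length-map parent F′)
                      (suc-injective (trans (+-comm 1 (length F′))
                                            (trans (sym (length-++ F′)) (trans (cong length (sym F≡)) length-F))))
    take-β : take β s ≡ map parent F′
    take-β = begin
      take β s                                   ≡⟨ take-slitherCode (<⇒≤ β<F) ⟩
      take β (map parent F)                      ≡⟨ cong (take β) (map-parent-∷ʳ F≡) ⟩
      take β (map parent F′ ++ [ parent c ])
        ≡⟨ cong (λ k → take k (map parent F′ ++ [ parent c ])) (sym length-F′) ⟩
      take (length (map parent F′)) (map parent F′ ++ [ parent c ])
        ≡⟨ take-length-++ (map parent F′) [ parent c ] ⟩
      map parent F′                              ∎
    twice : 2 ≤ countᵇ (parent c ≡ᵇ_) (map parent F′)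
    twice = lastParent-twice F≡ Proot (subst (λ xs → nPositions ≤ doublets xs) take-β nPositions≤)

proposition12 : ∀ {n} (T : RootedTree n) (P : _ → _) → IsPNClassification T P →
    let s = slitherCode T P in
    (β : ℕ) → n ∸ 1 ∸ β ≤ doublets (take β s) →
    (∀ γ → γ < β → doublets (take γ s) < n ∸ 1 ∸ γ) →
    IsMaxPathCollectionSize T (length (discardThird (take β s)))
proposition12 T P cls β enough minimal =
  subst (IsMaxPathCollectionSize T) (sym length≡capacity) (maxPathCollection T P cls)
  where
  length≡capacity : length (discardThird (take β (slitherCode T P))) ≡ capacity T P cls
  length≡capacity = trans (cong length (discardThird-minimalPrefix T P cls β enough minimal))
                          (length-discardThird-parents T P cls)
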